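{- Let $\lambda\subseteq\gamma$ be partitions and let $T$ be a semi-standard tableau of skew shape $\gamma/\lambda$. Then $T$ is a Littlewood–Richardson tableau if and only if the set of labeled cells of $T$ can be partitioned into ballot sequences.
   Context: Partitions are drawn as Young diagrams in English convention; the cell in row $i$ (from the top) and column $j$ (from the left) has coordinates $(i,j)$. For partitions $\lambda\subseteq\gamma$ (with $\lambda$ padded by zeros), the skew shape $\gamma/\lambda$ is the set of cells $(i,j)$ with $\lambda_i<j\le\gamma_i$. A semi-standard tableau of shape $\gamma/\lambda$ labels each cell by a positive integer so that labels weakly increase from left to right along rows and strictly increase from top to bottom along columns. Its reverse row word is obtained by reading the labels in each row from right to left, starting with the top row and proceeding downward. A word $w_1\cdots w_m$ of positive integers is a lattice word if for every prefix $w_1\cdots w_i$ and every $b\ge 2$, the number of occurrences of $b$ in the prefix is at most the number of occurrences of $b-1$. A Littlewood–Richardson (LR) tableau is a semi-standard skew tableau whose reverse row word is a lattice word. A labeled cell $c$ with label $a$ is written $[c,a]$. A ballot sequence in a tableau is a sequence of labeled cells $[(i_k,j_k),k],\ldots,[(i_2,j_2),2],[(i_1,j_1),1]$ (so the labels are exactly $1,2,\ldots,k$) such that $i_r>i_{r-1}$ and $j_r\le j_{r-1}$ for all $1<r\le k$. -}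

module Defs where

open import Data.Nat using (ℕ; zero; suc; _≤_; _<_; _∸_; _+_; _≟_)
open import Data.List using (List; []; _∷_; map; concat; concatMap; upTo; take; reverse; length; filter)
open import Data.List.Relation.Unary.All using (All)
open import Data.List.Relation.Binary.Permutation.Propositional using (_↭_)
open import Data.Product using (_×_; _,_; proj₁; proj₂; ∃-syntax)
open import Data.Unit using (⊤)
open import Relation.Binary.PropositionalEquality using (_≡_; _≢_)

-- Partitions are finite lists of parts (row lengths), top row first.
-- A partition: weakly decreasing list of positive integers.
data IsPartition : List ℕ → Set where
  []  : IsPartition []
  [_] : ∀ {a} → 1 ≤ a → IsPartition (a ∷ [])
  _∷_ : ∀ {a b xs} → 1 ≤ a → b ≤ a → IsPartition (b ∷ xs) → IsPartition (a ∷ b ∷ xs)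

-- i-th part, rows indexed from 1, padded with zeros (index 0 also gives 0).
_!_ : List ℕ → ℕ → ℕ
[]       ! _           = 0
(x ∷ xs) ! zero        = 0
(x ∷ xs) ! suc zero    = x
(x ∷ xs) ! suc (suc i) = xs ! suc i

_⊆ₚ_ : List ℕ → List ℕ → Set
lam ⊆ₚ gam = ∀ i → lam ! i ≤ gam ! i

Cell : Set
Cell = ℕ × ℕ   -- (row i, column j), 1-based

InShape : List ℕ → List ℕ → Cell → Set
InShape lam gam (i , j) = 1 ≤ i × lam ! i < j × j ≤ gam ! i

-- A tableau is a labelling of cells by natural numbers (only values on the shape matter).
Tableau : Set
Tableau = ℕ → ℕ → ℕ

SemiStandard : List ℕ → List ℕ → Tableau → Set
SemiStandard lam gam T =
  (∀ i j → InShape lam gam (i , j) → 1 ≤ T i j) ×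
  (∀ i j j' → InShape lam gam (i , j) → InShape lam gam (i , j') → j ≤ j' → T i j ≤ T i j') ×
  (∀ i i' j → InShape lam gam (i , j) → InShape lam gam (i' , j) → i < i' → T i j < T i' j)

rowCols : List ℕ → List ℕ → ℕ → List ℕ
rowCols lam gam i = map (λ k → suc (lam ! i + k)) (upTo (gam ! i ∸ lam ! i))

rows : List ℕ → List ℕ
rows gam = map suc (upTo (length gam))

reverseRowWord : List ℕ → List ℕ → Tableau → List ℕ
reverseRowWord lam gam T = concatMap (λ i → reverse (map (T i) (rowCols lam gam i))) (rows gam)

count : ℕ → List ℕ → ℕ
count b w = length (filter (_≟ b) w)

LatticeWord : List ℕ → Set
LatticeWord w = ∀ n b → count (suc (suc b)) (take n w) ≤ count (suc b) (take n w)

LRTableau : List ℕ → List ℕ → Tableau → Set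
LRTableau lam gam T = SemiStandard lam gam T × LatticeWord (reverseRowWord lam gam T)

LCell : Set
LCell = Cell × ℕ

cells : List ℕ → List ℕ → List Cell
cells lam gam = concatMap (λ i → map (λ j → (i , j)) (rowCols lam gam i)) (rows gam)

labeledCells : List ℕ → List ℕ → Tableau → List LCell
labeledCells lam gam T = map (λ c → c , T (proj₁ c) (proj₂ c)) (cells lam gam)

-- consecutive condition: next cell (label r) vs previous (label r-1):
-- i_r > i_{r-1} and j_r ≤ j_{r-1}
Next : LCell → List LCell → Set
Next _ [] = ⊤
Next ((i , j) , _) (((i' , j') , _) ∷ _) = i < i' × j' ≤ j

Ascending : ℕ → List LCell → Set
Ascending n [] = ⊤
Ascending n (x ∷ xs) = proj₂ x ≡ n × Next x xs × Ascending (suc n) xs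

-- ballot sequence [c_k,k], ..., [c_1,1], k ≥ 1, written as in the paper
BallotSequence : List LCell → Set
BallotSequence s = s ≢ [] × Ascending 1 (reverse s)

PartitionedIntoBallot : List ℕ → List ℕ → Tableau → Set
PartitionedIntoBallot lam gam T =
  ∃[ ss ] (All BallotSequence ss × concat ss ↭ labeledCells lam gam T)

-- Read the cells of T in the order of the reverse row word. If this word is a lattice word, scan
-- it and put each cell c labelled β + 1 on top of the sequence ending in the β-cell d of the same
-- rank (the k-th β + 1 goes on the k-th β). The lattice condition makes d exist and be read before
-- c, so d lies in a higher row: on c's own row it would be right of c, against weakly increasing
-- rows. Strictly increasing columns forbid c to lie right of d when the rows are two or more
-- apart; for adjacent rows this is forbidden by the lattice condition applied below the first β
-- of the run of β's through d. Conversely, in a ballot sequence the cell labelled β lies in a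
-- higher row than the one labelled β + 1, so every prefix of the reading word contains, from
-- each sequence, at least as many β's as β + 1's.

module Submission where

open import Defs
open import Data.Nat
  using (ℕ; zero; suc; _+_; _∸_; _≤_; _<_; _≤′_; ≤′-refl; ≤′-step; z≤n; s≤s; _≟_; _≤?_)
open import Data.Nat.Properties
open import Data.List
  using (List; []; _∷_; _++_; _∷ʳ_; map; concat; concatMap; upTo; take; drop; reverse; length; filter;
         applyUpTo; applyDownFrom)
open import Data.List.Properties
  using (∷-injective; ++-assoc; ++-identityʳ; ++-conicalʳ; length-++; map-++; map-∘; take-map; take++drop≡id;
         unfold-reverse; upTo-∷ʳ; map-upTo; map-applyDownFrom; length-applyDownFrom; applyDownFrom-∷ʳ;
         concatMap-cong; concatMap-++; map-concatMap; filter-++; filter-accept; filter-reject; filter-all; filter-none)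
open import Data.List.Relation.Unary.All using (All; []; _∷_)
import Data.List.Relation.Unary.All as All
import Data.List.Relation.Unary.All.Properties as Allₚ
open import Data.List.Relation.Unary.Any using (Any; here; there)
open import Data.List.Relation.Unary.AllPairs using (AllPairs; []; _∷_)
import Data.List.Relation.Unary.AllPairs.Properties as APₚ
open import Data.List.Membership.Propositional using (_∈_; _∉_)
open import Data.List.Membership.Propositional.Properties using (∈-++⁻; ∈-++⁺ʳ)
open import Data.List.Relation.Binary.Permutation.Propositional
  using (_↭_; ↭-refl; ↭-sym; ↭-trans; ↭-prep; ↭-reflexive)
open import Data.List.Relation.Binary.Permutation.Propositional.Properties
  using (filter-↭; ↭-length; ↭-reverse; ++⁺; ++⁺ˡ; shift; ∷↭∷ʳ; ∈-resp-↭; All-resp-↭)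
open import Data.Product using (_×_; _,_; proj₁; proj₂; ∃-syntax)
open import Data.Product.Properties using (≡-dec)
open import Data.Sum using (_⊎_; inj₁; inj₂)
open import Data.Empty using (⊥; ⊥-elim)
open import Relation.Nullary using (¬_; Dec; yes; no; contradiction)
open import Relation.Nullary.Decidable using (_×-dec_)
open import Relation.Unary using (Pred; Decidable; ∁)
open import Relation.Binary.Core using (Rel)
open import Relation.Binary.PropositionalEquality
open import Function using (_∘_)
open import Function.Bundles using (_⇔_; mk⇔)

-- Lists, counting and stacks of sequences

module _ {a} {A : Set a} where

  ++-∷-split : ∀ (xs ys ws : List A) {e Z} → xs ++ ys ≡ ws ++ e ∷ Z →
    (∃[ Z′ ] xs ≡ ws ++ e ∷ Z′) ⊎ (∃[ vs ] ws ≡ xs ++ vs × ys ≡ vs ++ e ∷ Z)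
  ++-∷-split []       ys ws        eq = inj₂ (ws , refl , eq)
  ++-∷-split (x ∷ xs) ys []        eq with refl , _ ← ∷-injective eq = inj₁ (xs , refl)
  ++-∷-split (x ∷ xs) ys (_ ∷ ws)  eq with refl , eq′ ← ∷-injective eq with ++-∷-split xs ys ws eq′
  ... | inj₁ (Z′ , p)      = inj₁ (Z′ , cong (x ∷_) p)
  ... | inj₂ (vs , p , q) = inj₂ (vs , cong (x ∷_) p , q)

  ∷ʳ-split : ∀ (xs ws : List A) {c e C} → xs ++ c ∷ [] ≡ ws ++ e ∷ C →
    (ws ≡ xs × e ≡ c) ⊎ (∃[ C′ ] xs ≡ ws ++ e ∷ C′)
  ∷ʳ-split xs ws eq with ++-∷-split xs _ ws eq
  ... | inj₁ (C′ , p)            = inj₂ (C′ , p)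
  ... | inj₂ ([] , p , q)        = inj₁ (trans p (++-identityʳ xs) , sym (proj₁ (∷-injective q)))
  ... | inj₂ (_ ∷ vs , _ , q)
    with () ← ++-conicalʳ vs _ (sym (proj₂ (∷-injective q)))

module _ {a ℓ} {A : Set a} {R : Rel A ℓ} where

  AllPairs-across : ∀ {xs ys x y} → AllPairs R (xs ++ ys) → x ∈ xs → y ∈ ys → R x y
  AllPairs-across {_ ∷ xs} (rs ∷ _)   (here refl) y∈ys = All.lookup (Allₚ.++⁻ʳ xs rs) y∈ys
  AllPairs-across {_ ∷ xs} (_ ∷ rss) (there x∈xs) y∈ys = AllPairs-across rss x∈xs y∈ys

  AllPairs-split-unique : (∀ {x} → ¬ R x x) → ∀ {xs x} (A₁ A₂ : List A) {C₁ C₂} → AllPairs R xs →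
    xs ≡ A₁ ++ x ∷ C₁ → xs ≡ A₂ ++ x ∷ C₂ → A₁ ≡ A₂
  AllPairs-split-unique irr []       []       _ refl refl = refl
  AllPairs-split-unique irr []       (_ ∷ A₂) (rs ∷ _) refl eq with refl , refl ← ∷-injective eq =
    ⊥-elim (irr (All.lookup (Allₚ.++⁻ʳ A₂ rs) (here refl)))
  AllPairs-split-unique irr (_ ∷ A₁) []       (rs ∷ _) refl eq with refl , refl ← ∷-injective eq =
    ⊥-elim (irr (All.lookup (Allₚ.++⁻ʳ A₁ rs) (here refl)))
  AllPairs-split-unique irr (a₁ ∷ A₁) (a₂ ∷ A₂) (_ ∷ rss) refl eq with refl , eq′ ← ∷-injective eq =
    cong (a₁ ∷_) (AllPairs-split-unique irr A₁ A₂ rss refl eq′)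

module _ {a p} {A : Set a} {P : Pred A p} (P? : Decidable P) where

  countWhere : List A → ℕ
  countWhere xs = length (filter P? xs)

  countWhere-++ : ∀ xs ys → countWhere (xs ++ ys) ≡ countWhere xs + countWhere ys
  countWhere-++ xs ys = trans (cong length (filter-++ P? xs ys)) (length-++ (filter P? xs))

  countWhere-≤-++ : ∀ xs ys → countWhere xs ≤ countWhere (xs ++ ys)
  countWhere-≤-++ xs ys = subst (countWhere xs ≤_) (sym (countWhere-++ xs ys)) (m≤m+n _ _)

  countWhere-↭ : ∀ {xs ys} → xs ↭ ys → countWhere xs ≡ countWhere ys
  countWhere-↭ p = ↭-length (filter-↭ P? p)

  countWhere-all : ∀ {xs} → All P xs → countWhere xs ≡ length xs
  countWhere-all ps = cong length (filter-all P? ps)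

  countWhere-none : ∀ {xs} → All (∁ P) xs → countWhere xs ≡ 0
  countWhere-none ps = cong length (filter-none P? ps)

  countWhere-accept : ∀ {x} xs → P x → countWhere (x ∷ xs) ≡ suc (countWhere xs)
  countWhere-accept xs px = cong length (filter-accept P? px)

  countWhere-reject : ∀ {x} xs → ¬ P x → countWhere (x ∷ xs) ≡ countWhere xs
  countWhere-reject xs ¬px = cong length (filter-reject P? ¬px)

  countWhere-∷ʳ-accept : ∀ xs {x} → P x → countWhere (xs ++ x ∷ []) ≡ suc (countWhere xs)
  countWhere-∷ʳ-accept xs px =
    trans (countWhere-++ xs _) (trans (cong (λ ys → countWhere xs + length ys) (filter-accept P? px)) (+-comm _ 1))

  countWhere-∷ʳ-reject : ∀ xs {x} → ¬ P x → countWhere (xs ++ x ∷ []) ≡ countWhere xs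
  countWhere-∷ʳ-reject xs ¬px =
    trans (countWhere-++ xs _) (trans (cong (λ ys → countWhere xs + length ys) (filter-reject P? ¬px)) (+-identityʳ _))

  countWhere-occurrence : ∀ k xs → k < countWhere xs →
    ∃[ B ] ∃[ d ] ∃[ C ] (xs ≡ B ++ d ∷ C × P d × countWhere B ≡ k)
  countWhere-occurrence k (x ∷ xs) k< with P? x
  countWhere-occurrence zero (x ∷ xs) k< | yes px = [] , x , xs , refl , px , refl
  countWhere-occurrence (suc k) (x ∷ xs) k< | yes px
    with B , d , C , eq , pd , n ← countWhere-occurrence k xs (≤-pred k<) =
    x ∷ B , d , C , cong (x ∷_) eq , pd , trans (countWhere-accept B px) (cong suc n)
  countWhere-occurrence k (x ∷ xs) k< | no ¬px
    with B , d , C , eq , pd , n ← countWhere-occurrence k xs k< =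
    x ∷ B , d , C , cong (x ∷_) eq , pd , trans (countWhere-reject B ¬px) n

countWhere-map : ∀ {a b p} {A : Set a} {B : Set b} {P : Pred B p} (P? : Decidable P) (f : A → B) xs →
  countWhere P? (map f xs) ≡ countWhere (P? ∘ f) xs
countWhere-map P? f []       = refl
countWhere-map P? f (x ∷ xs) with P? (f x)
... | yes _ = cong suc (countWhere-map P? f xs)
... | no  _ = countWhere-map P? f xs

module _ {a p q} {A : Set a} {P : Pred A p} {Q : Pred A q} (P? : Decidable P) (Q? : Decidable Q) where

  countWhere-×-all : ∀ {xs} → All Q xs → countWhere (λ x → P? x ×-dec Q? x) xs ≡ countWhere P? xs
  countWhere-×-all {[]}     []         = refl
  countWhere-×-all {x ∷ xs} (qx ∷ qxs) with P? x | Q? x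
  ... | yes _ | yes _  = cong suc (countWhere-×-all qxs)
  ... | yes _ | no ¬qx = contradiction qx ¬qx
  ... | no  _ | _      = countWhere-×-all qxs

  countWhere-×-none : ∀ {xs} → All (∁ Q) xs → countWhere (λ x → P? x ×-dec Q? x) xs ≡ 0
  countWhere-×-none ¬qs = countWhere-none (λ x → P? x ×-dec Q? x) (All.map (_∘ proj₂) ¬qs)

module _ {a} {A : Set a} where

  applyDownFrom-+ : ∀ (f : ℕ → A) m n →
    applyDownFrom f (m + n) ≡ applyDownFrom (f ∘ (m +_)) n ++ applyDownFrom f m
  applyDownFrom-+ f m zero    rewrite +-identityʳ m = refl
  applyDownFrom-+ f m (suc n) rewrite +-suc m n = cong (f (m + n) ∷_) (applyDownFrom-+ f m n)

  applyDownFrom-cong : ∀ {f g : ℕ → A} → (∀ k → f k ≡ g k) →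
    ∀ n → applyDownFrom f n ≡ applyDownFrom g n
  applyDownFrom-cong f≗g zero    = refl
  applyDownFrom-cong f≗g (suc n) = cong₂ _∷_ (f≗g n) (applyDownFrom-cong f≗g n)

  applyDownFrom-∷-split : ∀ (f : ℕ → A) n B {e Z} → applyDownFrom f n ≡ B ++ e ∷ Z →
    ∃[ k ] (k < n × e ≡ f k × B ++ e ∷ [] ≡ applyDownFrom (f ∘ (k +_)) (n ∸ k))
  applyDownFrom-∷-split f (suc n) [] eq with refl , _ ← ∷-injective eq =
    n , ≤-refl , refl , trans (cong (λ m → f m ∷ []) (sym (+-identityʳ n)))
                               (cong (applyDownFrom (f ∘ (n +_))) (sym (m+n∸n≡m 1 n)))
  applyDownFrom-∷-split f (suc n) (b ∷ B) eq with refl , eq′ ← ∷-injective eq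
    with k , k<n , e≡ , B≡ ← applyDownFrom-∷-split f n B eq′ =
    k , m<n⇒m<1+n k<n , e≡ , trans (cong₂ _∷_ (cong f (sym (m+[n∸m]≡n (<⇒≤ k<n)))) B≡)
                                  (cong (applyDownFrom (f ∘ (k +_))) (sym (+-∸-assoc 1 (<⇒≤ k<n))))

  reverse-applyUpTo : ∀ (f : ℕ → A) n → reverse (applyUpTo f n) ≡ applyDownFrom f n
  reverse-applyUpTo f zero    = refl
  reverse-applyUpTo f (suc n) = begin
    reverse (f 0 ∷ applyUpTo (f ∘ suc) n)      ≡⟨ unfold-reverse (f 0) (applyUpTo (f ∘ suc) n) ⟩
    reverse (applyUpTo (f ∘ suc) n) ∷ʳ f 0     ≡⟨ cong (_∷ʳ f 0) (reverse-applyUpTo (f ∘ suc) n) ⟩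
    applyDownFrom (f ∘ suc) n ∷ʳ f 0           ≡⟨ applyDownFrom-∷ʳ f n ⟩
    applyDownFrom f (suc n)                     ∎
    where open ≡-Reasoning

module _ {a b} {A : Set a} {B : Set b} where

  concatMap-↭ : ∀ {f g : A → List B} → (∀ x → f x ↭ g x) → ∀ xs → concatMap f xs ↭ concatMap g xs
  concatMap-↭ f↭g []       = ↭-refl
  concatMap-↭ f↭g (x ∷ xs) = ++⁺ (f↭g x) (concatMap-↭ f↭g xs)

least-satisfying : ∀ {p} {P : ℕ → Set p} → Decidable P → ∀ {a z} → a ≤ z → P z →
  ∃[ x ] (a ≤ x × x ≤ z × P x × ∀ {y} → a ≤ y → y < x → ¬ P y)
least-satisfying {P = P} P? {a} a≤z Pz =
  let x , a≤x , x≤ , Px , below = search a (subst P (sym (m+[n∸m]≡n a≤z)) Pz)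
  in x , a≤x , ≤-trans x≤ (≤-reflexive (m+[n∸m]≡n a≤z)) , Px , below
  where
  search : ∀ a {n} → P (a + n) → ∃[ x ] (a ≤ x × x ≤ a + n × P x × ∀ {y} → a ≤ y → y < x → ¬ P y)
  search a Pa+n with P? a
  ... | yes Pa = a , ≤-refl , m≤m+n a _ , Pa , λ a≤y y<a → contradiction a≤y (<⇒≱ y<a)
  search a {zero}  Pa+n | no ¬Pa = contradiction (subst P (+-identityʳ a) Pa+n) ¬Pa
  search a {suc n} Pa+n | no ¬Pa with x , a<x , x≤ , Px , below ← search (suc a) (subst P (+-suc a n) Pa+n) =
    x , <⇒≤ a<x , ≤-trans x≤ (≤-reflexive (sym (+-suc a n))) , Px , below′
    where
    below′ : ∀ {y} → a ≤ y → y < x → ¬ P y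
    below′ {y} a≤y y<x with a ≟ y
    ... | yes refl = ¬Pa
    ... | no a≢y   = below (≤∧≢⇒< a≤y a≢y) y<x

∸-telescope : ∀ {a b c} → a ≤ b → b ≤ c → (b ∸ a) + (c ∸ b) ≡ c ∸ a
∸-telescope {a} {b} {c} a≤b b≤c = sym (trans (cong (_∸ a) (sym (m+[n∸m]≡n b≤c))) (+-∸-comm (c ∸ b) a≤b))

module _ {a} {A : Set a} where

  TopIs : A → List A → Set a
  TopIs d s = ∃[ t ] s ≡ d ∷ t

  pushOnto : ∀ {d ss} → Any (TopIs d) ss → A → List (List A)
  pushOnto {ss = s ∷ ss} (here _)  c = (c ∷ s) ∷ ss
  pushOnto {ss = s ∷ ss} (there p) c = s ∷ pushOnto p c

  module _ {d c : A} where

    pushOnto-concat : ∀ {ss} (p : Any (TopIs d) ss) → concat (pushOnto p c) ↭ c ∷ concat ss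
    pushOnto-concat             (here _)  = ↭-refl
    pushOnto-concat {ss = s ∷ _} (there p) = ↭-trans (++⁺ˡ s (pushOnto-concat p)) (shift c s _)

    pushOnto-All : ∀ {q} {Q : Pred (List A) q} {ss} (p : Any (TopIs d) ss) →
      (∀ {s} → TopIs d s → Q s → Q (c ∷ s)) → All Q ss → All Q (pushOnto p c)
    pushOnto-All (here top) f (qs ∷ qss) = f top qs ∷ qss
    pushOnto-All (there p)  f (qs ∷ qss) = qs ∷ pushOnto-All p f qss

    pushOnto-top : ∀ {ss} (p : Any (TopIs d) ss) → Any (TopIs c) (pushOnto p c)
    pushOnto-top {s ∷ _} (here _)  = here (s , refl)
    pushOnto-top         (there p) = there (pushOnto-top p)

    pushOnto-keeps : ∀ {e ss} (p : Any (TopIs d) ss) → e ≢ d → Any (TopIs e) ss → Any (TopIs e) (pushOnto p c)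
    pushOnto-keeps (here (_ , refl)) e≢d (here (_ , eq)) = contradiction (sym (proj₁ (∷-injective eq))) e≢d
    pushOnto-keeps (here _)          e≢d (there q)       = there q
    pushOnto-keeps (there p)         e≢d (here q)        = here q
    pushOnto-keeps (there p)         e≢d (there q)       = there (pushOnto-keeps p e≢d q)

-- Skew shapes and labelled cells

!-antitone : ∀ {xs} → IsPartition xs → ∀ {i i′} → i ≤ i′ → xs ! suc i′ ≤ xs ! suc i
!-antitone {xs} p i≤i′ = go (≤⇒≤′ i≤i′)
  where
  step : ∀ {xs} → IsPartition xs → ∀ i → xs ! suc (suc i) ≤ xs ! suc i
  step []            _       = z≤n
  step [ _ ]         _       = z≤n
  step (_∷_ _ b≤a _) zero    = b≤a
  step (_∷_ _ _ p)   (suc i) = step p i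
  go : ∀ {i i′} → i ≤′ i′ → xs ! suc i′ ≤ xs ! suc i
  go ≤′-refl      = ≤-refl
  go (≤′-step h) = ≤-trans (step p _) (go h)

!-nonzero : ∀ xs i → 0 < xs ! suc i → suc i ≤ length xs
!-nonzero (_ ∷ _)  zero    _   = s≤s z≤n
!-nonzero (_ ∷ xs) (suc i) pos = s≤s (!-nonzero xs i pos)

skewShape-convex : ∀ {lam gam} → IsPartition lam → IsPartition gam →
  ∀ {r j r′ j′ i y} → InShape lam gam (r , j) → InShape lam gam (r′ , j′) →
  r ≤ i → i ≤ r′ → j ≤ y → y ≤ j′ → InShape lam gam (i , y)
skewShape-convex Pl Pg {suc _} {r′ = suc _} {i = suc _} (_ , λ<j , _) (_ , _ , j′≤γ)
                 (s≤s r≤i) (s≤s i≤r′) j≤y y≤j′ =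
  s≤s z≤n ,
  ≤-<-trans (!-antitone Pl r≤i) (<-≤-trans λ<j j≤y) ,
  ≤-trans (≤-trans y≤j′ j′≤γ) (!-antitone Pg i≤r′)

row col : LCell → ℕ
row = proj₁ ∘ proj₁
col = proj₂ ∘ proj₁

-- e is read before e′ in the reverse row word
_≺_ : LCell → LCell → Set
e ≺ e′ = row e < row e′ ⊎ (row e ≡ row e′ × col e′ < col e)

≺-irrefl : ∀ {e} → ¬ e ≺ e
≺-irrefl (inj₁ r<r)       = <-irrefl refl r<r
≺-irrefl (inj₂ (_ , c<c)) = <-irrefl refl c<c

LatticeWord-prefix : ∀ w v → LatticeWord (w ++ v) → ∀ b → count (suc (suc b)) w ≤ count (suc b) w
LatticeWord-prefix w v lat b =
  subst₂ _≤_ (cong (count _) (take-length w)) (cong (count _) (take-length w)) (lat (length w) b)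
  where
  take-length : ∀ w → take (length w) (w ++ v) ≡ w
  take-length []      = refl
  take-length (x ∷ w) = cong (x ∷_) (take-length w)

labelCount : ℕ → List LCell → ℕ
labelCount c = countWhere (λ e → proj₂ e ≟ c)

LatticeWord-labelPrefix : ∀ {L} A Z → LatticeWord (map proj₂ L) → L ≡ A ++ Z →
  ∀ b → labelCount (suc (suc b)) A ≤ labelCount (suc b) A
LatticeWord-labelPrefix A Z lat refl b =
  subst₂ _≤_ (countWhere-map (_≟ _) proj₂ A) (countWhere-map (_≟ _) proj₂ A)
  (LatticeWord-prefix (map proj₂ A) (map proj₂ Z) (subst LatticeWord (map-++ proj₂ A Z) lat) b)

Next-∷ʳ : ∀ w xs {y z} → Next w (xs ++ y ∷ []) → Next w (xs ++ y ∷ z ∷ [])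
Next-∷ʳ w []      n = n
Next-∷ʳ w (_ ∷ _) n = n

Ascending-∷ʳ : ∀ {n} xs {d c} → Ascending n (xs ++ d ∷ []) → Next d (c ∷ []) →
  proj₂ c ≡ suc (proj₂ d) → Ascending n (xs ++ d ∷ c ∷ [])
Ascending-∷ʳ []       (ld , _ , _)      nx lc = ld , nx , trans lc (cong suc ld) , _ , _
Ascending-∷ʳ (x ∷ xs) (lx , nx′ , asc) nx lc = lx , Next-∷ʳ x xs nx′ , Ascending-∷ʳ xs asc nx lc

BallotSequence-∷ : ∀ {s d c} → BallotSequence s → TopIs d s → Next d (c ∷ []) →
  proj₂ c ≡ suc (proj₂ d) → BallotSequence (c ∷ s)
BallotSequence-∷ {d = d} {c} (_ , asc) (t , refl) nx lc =
  (λ ()) , subst (Ascending 1) (sym rev)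
             (Ascending-∷ʳ (reverse t) (subst (Ascending 1) (unfold-reverse d t) asc) nx lc)
  where
  rev : reverse (c ∷ d ∷ t) ≡ reverse t ++ d ∷ c ∷ []
  rev = trans (unfold-reverse c (d ∷ t)) (trans (cong (_∷ʳ c) (unfold-reverse d t)) (++-assoc (reverse t) _ _))

-- The reverse row word

module Reading (lam gam : List ℕ) (T : Tableau) where

  cellAt : ℕ → ℕ → LCell
  cellAt i j = (i , j) , T i j

  segment : ℕ → ℕ → ℕ → List LCell
  segment i x = applyDownFrom (λ k → cellAt i (x + k))

  rowReading : ℕ → List LCell
  rowReading i = segment i (suc (lam ! i)) (gam ! i ∸ lam ! i)

  readingUpTo : ℕ → List LCell
  readingUpTo zero    = []
  readingUpTo (suc m) = readingUpTo m ++ rowReading (suc m)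

  readingList : List LCell
  readingList = readingUpTo (length gam)

  -- the cells read up to and including cell (i , x)
  readingTo : ℕ → ℕ → List LCell
  readingTo zero    x = []
  readingTo (suc r) x = readingUpTo r ++ segment (suc r) x (suc (gam ! suc r) ∸ x)

  readingUpTo-concatMap : ∀ m → readingUpTo m ≡ concatMap rowReading (map suc (upTo m))
  readingUpTo-concatMap zero    = refl
  readingUpTo-concatMap (suc m) = begin
    readingUpTo m ++ rowReading (suc m)
      ≡⟨ cong₂ _++_ (readingUpTo-concatMap m) (sym (++-identityʳ _)) ⟩
    concatMap rowReading (map suc (upTo m)) ++ concatMap rowReading (suc m ∷ [])
      ≡⟨ sym (concatMap-++ rowReading (map suc (upTo m)) _) ⟩
    concatMap rowReading (map suc (upTo m) ++ suc m ∷ [])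
      ≡⟨ cong (concatMap rowReading) (sym (map-++ suc (upTo m) _)) ⟩
    concatMap rowReading (map suc (upTo m ∷ʳ m))
      ≡⟨ cong (concatMap rowReading ∘ map suc) (upTo-∷ʳ m) ⟩
    concatMap rowReading (map suc (upTo (suc m)))
      ∎
    where open ≡-Reasoning

  rowCols≡ : ∀ {b} {B : Set b} (f : ℕ → B) i →
    map f (rowCols lam gam i) ≡ applyUpTo (λ k → f (suc (lam ! i + k))) (gam ! i ∸ lam ! i)
  rowCols≡ f i = trans (sym (map-∘ (upTo _))) (map-upTo _ _)

  reverseRowWord≡ : reverseRowWord lam gam T ≡ map proj₂ readingList
  reverseRowWord≡ = begin
    concatMap (λ i → reverse (map (T i) (rowCols lam gam i))) (rows gam)
      ≡⟨ concatMap-cong (λ i → trans (cong reverse (rowCols≡ (T i) i)) (reverse-applyUpTo _ _)) (rows gam) ⟩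
    concatMap (λ i → applyDownFrom (λ k → T i (suc (lam ! i + k))) (gam ! i ∸ lam ! i)) (rows gam)
      ≡⟨ concatMap-cong (λ i → sym (map-applyDownFrom _ proj₂ _)) (rows gam) ⟩
    concatMap (map proj₂ ∘ rowReading) (rows gam)
      ≡⟨ sym (map-concatMap proj₂ rowReading (rows gam)) ⟩
    map proj₂ (concatMap rowReading (rows gam))
      ≡⟨ cong (map proj₂) (sym (readingUpTo-concatMap (length gam))) ⟩
    map proj₂ readingList
      ∎
    where open ≡-Reasoning

  labeledCells↭readingList : labeledCells lam gam T ↭ readingList
  labeledCells↭readingList = ↭-trans (↭-reflexive (map-concatMap _ _ (rows gam)))
    (↭-trans (concatMap-↭ row↭ (rows gam)) (↭-reflexive (sym (readingUpTo-concatMap (length gam)))))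
    where
    row↭ : ∀ i → map (λ c → c , T (proj₁ c) (proj₂ c)) (map (i ,_) (rowCols lam gam i)) ↭ rowReading i
    row↭ i = ↭-trans (↭-reflexive (trans (sym (map-∘ (rowCols lam gam i))) (rowCols≡ (cellAt i) i)))
               (↭-trans (↭-sym (↭-reverse _)) (↭-reflexive (reverse-applyUpTo _ _)))

  segment-shift : ∀ i x m n → segment i (x + m) n ≡ applyDownFrom (λ l → cellAt i (x + (m + l))) n
  segment-shift i x m = applyDownFrom-cong (λ l → cong (cellAt i) (+-assoc x m l))

  segment-++ : ∀ i x m n → segment i x (m + n) ≡ segment i (x + m) n ++ segment i x m
  segment-++ i x m n = trans (applyDownFrom-+ _ m n) (cong (_++ segment i x m) (sym (segment-shift i x m n)))

  segment-All : ∀ {q} {Q : Pred LCell q} i x n → (∀ {y} → x ≤ y → y < x + n → Q (cellAt i y)) →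
    All Q (segment i x n)
  segment-All i x n h = Allₚ.applyDownFrom⁺₁ _ n (λ k<n → h (m≤m+n x _) (+-monoʳ-< x k<n))

  segment-sorted : ∀ i x n → AllPairs _≺_ (segment i x n)
  segment-sorted i x n = APₚ.applyDownFrom⁺₁ _ n (λ k<l _ → inj₂ (refl , +-monoʳ-< x k<l))

  readingUpTo-rows : ∀ m → All (λ e → row e ≤ m) (readingUpTo m)
  readingUpTo-rows zero    = []
  readingUpTo-rows (suc m) = Allₚ.++⁺ (All.map m≤n⇒m≤1+n (readingUpTo-rows m))
                                     (Allₚ.applyDownFrom⁺₂ _ _ (λ _ → ≤-refl))

  readingUpTo-sorted : ∀ m → AllPairs _≺_ (readingUpTo m)
  readingUpTo-sorted zero    = []
  readingUpTo-sorted (suc m) = APₚ.++⁺ (readingUpTo-sorted m) (segment-sorted _ _ _)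
    (All.map (λ r≤m → Allₚ.applyDownFrom⁺₂ _ _ (λ _ → inj₁ (s≤s r≤m))) (readingUpTo-rows m))

  readingList-sorted : AllPairs _≺_ readingList
  readingList-sorted = readingUpTo-sorted (length gam)

  readingUpTo-prefix : ∀ {m n} → m ≤ n → ∃[ Z ] readingUpTo n ≡ readingUpTo m ++ Z
  readingUpTo-prefix m≤n = go (≤⇒≤′ m≤n)
    where
    go : ∀ {m n} → m ≤′ n → ∃[ Z ] readingUpTo n ≡ readingUpTo m ++ Z
    go ≤′-refl = [] , sym (++-identityʳ _)
    go {m} (≤′-step {n} h) with Z , eq ← go h =
      Z ++ rowReading (suc n) , trans (cong (_++ rowReading (suc n)) eq) (++-assoc (readingUpTo m) Z _)

  readingTo-split : ∀ r {x z} → x ≤ z → z ≤ suc (gam ! suc r) →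
    readingTo (suc r) x ≡ readingTo (suc r) z ++ segment (suc r) x (z ∸ x)
  readingTo-split r {x} {z} x≤z z≤ = begin
    readingUpTo r ++ segment i x (suc (gam ! i) ∸ x)
      ≡⟨ cong (λ n → readingUpTo r ++ segment i x n) (sym (∸-telescope x≤z z≤)) ⟩
    readingUpTo r ++ segment i x ((z ∸ x) + (suc (gam ! i) ∸ z))
      ≡⟨ cong (readingUpTo r ++_) (segment-++ i x (z ∸ x) _) ⟩
    readingUpTo r ++ (segment i (x + (z ∸ x)) (suc (gam ! i) ∸ z) ++ segment i x (z ∸ x))
      ≡⟨ cong (λ y → readingUpTo r ++ (segment i y (suc (gam ! i) ∸ z) ++ segment i x (z ∸ x)))
              (m+[n∸m]≡n x≤z) ⟩
    readingUpTo r ++ (segment i z (suc (gam ! i) ∸ z) ++ segment i x (z ∸ x))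
      ≡⟨ sym (++-assoc (readingUpTo r) _ _) ⟩
    readingTo i z ++ segment i x (z ∸ x)
      ∎
    where
    open ≡-Reasoning
    i : ℕ
    i = suc r

  readingTo-rowEnd : ∀ r → readingTo (suc r) (suc (gam ! suc r)) ≡ readingUpTo r
  readingTo-rowEnd r =
    trans (cong (λ n → readingUpTo r ++ segment (suc r) (suc (gam ! suc r)) n) (n∸n≡0 (gam ! suc r)))
          (++-identityʳ _)

  readingTo-prefix : lam ⊆ₚ gam → ∀ {r x} → suc r ≤ length gam →
    lam ! suc r < x → x ≤ suc (gam ! suc r) → ∃[ Z ] readingList ≡ readingTo (suc r) x ++ Z
  readingTo-prefix sub {r} {x} r<ℓ λ<x x≤ with Z , eq ← readingUpTo-prefix r<ℓ =
    segment (suc r) _ (x ∸ suc (lam ! suc r)) ++ Z ,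
    trans eq (trans (cong (_++ Z) (readingTo-split r λ<x x≤)) (++-assoc (readingTo (suc r) x) _ Z))

  labelCount-readingTo-all : ∀ {c} r {x z} → x ≤ z → z ≤ suc (gam ! suc r) →
    (∀ {y} → x ≤ y → y < z → T (suc r) y ≡ c) →
    labelCount c (readingTo (suc r) x) ≡ labelCount c (readingTo (suc r) z) + (z ∸ x)
  labelCount-readingTo-all {c} r {x} {z} x≤z z≤ all = begin
    labelCount c (readingTo (suc r) x)
      ≡⟨ cong (labelCount c) (readingTo-split r x≤z z≤) ⟩
    labelCount c (readingTo (suc r) z ++ segment (suc r) x (z ∸ x))
      ≡⟨ countWhere-++ _ (readingTo (suc r) z) _ ⟩
    labelCount c (readingTo (suc r) z) + labelCount c (segment (suc r) x (z ∸ x))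
      ≡⟨ cong (labelCount c (readingTo (suc r) z) +_) segment-count ⟩
    labelCount c (readingTo (suc r) z) + (z ∸ x)
      ∎
    where
    open ≡-Reasoning
    segment-count : labelCount c (segment (suc r) x (z ∸ x)) ≡ z ∸ x
    segment-count = trans
      (countWhere-all _ (segment-All (suc r) x (z ∸ x) λ x≤y y< → all x≤y (subst (_ <_) (m+[n∸m]≡n x≤z) y<)))
      (length-applyDownFrom _ (z ∸ x))

  labelCount-readingTo-none : ∀ {c} r {x z} → x ≤ z → z ≤ suc (gam ! suc r) →
    (∀ {y} → x ≤ y → y < z → T (suc r) y ≢ c) →
    labelCount c (readingTo (suc r) x) ≡ labelCount c (readingTo (suc r) z)
  labelCount-readingTo-none {c} r {x} {z} x≤z z≤ none = begin
    labelCount c (readingTo (suc r) x)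
      ≡⟨ cong (labelCount c) (readingTo-split r x≤z z≤) ⟩
    labelCount c (readingTo (suc r) z ++ segment (suc r) x (z ∸ x))
      ≡⟨ countWhere-++ _ (readingTo (suc r) z) _ ⟩
    labelCount c (readingTo (suc r) z) + labelCount c (segment (suc r) x (z ∸ x))
      ≡⟨ cong (labelCount c (readingTo (suc r) z) +_) segment-count ⟩
    labelCount c (readingTo (suc r) z) + 0
      ≡⟨ +-identityʳ _ ⟩
    labelCount c (readingTo (suc r) z)
      ∎
    where
    open ≡-Reasoning
    segment-count : labelCount c (segment (suc r) x (z ∸ x)) ≡ 0
    segment-count =
      countWhere-none _ (segment-All (suc r) x (z ∸ x) λ x≤y y< → none x≤y (subst (_ <_) (m+[n∸m]≡n x≤z) y<))

  record Position (B : List LCell) (e : LCell) : Set where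
    constructor position
    field
      i j     : ℕ
      inShape : InShape lam gam (i , j)
      isCell  : e ≡ cellAt i j
      prefix  : B ++ e ∷ [] ≡ readingTo i j

  locate : lam ⊆ₚ gam → ∀ m B {e Z} → readingUpTo m ≡ B ++ e ∷ Z → Position B e
  locate sub zero    B eq with () ← ++-conicalʳ B _ (sym eq)
  locate sub (suc m) B eq with ++-∷-split (readingUpTo m) (rowReading (suc m)) B eq
  ... | inj₁ (_ , eq′) = locate sub m B eq′
  ... | inj₂ (B′ , refl , eq′)
    with k , k<n , refl , pre ← applyDownFrom-∷-split _ (gam ! suc m ∸ lam ! suc m) B′ eq′ =
    position (suc m) (suc lₘ + k) (s≤s z≤n , s≤s (m≤m+n lₘ k) , inRow) refl prefix
    where
    lₘ gₘ : ℕ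
    lₘ = lam ! suc m
    gₘ = gam ! suc m
    inRow : suc lₘ + k ≤ gₘ
    inRow = ≤-trans (≤-reflexive (sym (+-suc lₘ k)))
                    (≤-trans (+-monoʳ-≤ lₘ k<n) (≤-reflexive (m+[n∸m]≡n (sub (suc m)))))
    prefix : (readingUpTo m ++ B′) ++ _ ∷ [] ≡ readingTo (suc m) (suc lₘ + k)
    prefix = trans (++-assoc (readingUpTo m) B′ _) (cong (readingUpTo m ++_) (trans pre
      (trans (sym (segment-shift (suc m) (suc lₘ) k _)) (cong (segment (suc m) (suc lₘ + k)) (∸-+-assoc gₘ lₘ k)))))

-- A lattice reverse row word gives a partition into ballot sequences

module Matching {lam gam : List ℕ} {T : Tableau} (Pl : IsPartition lam) (Pg : IsPartition gam)
  (sub : lam ⊆ₚ gam) (SS : SemiStandard lam gam T) (lat : LatticeWord (map proj₂ (Reading.readingList lam gam T)))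
  where
  open Reading lam gam T

  rowWeak : ∀ {i y y′} → InShape lam gam (i , y) → InShape lam gam (i , y′) → y ≤ y′ → T i y ≤ T i y′
  rowWeak = proj₁ (proj₂ SS) _ _ _

  colStrict : ∀ {i i′ y} → InShape lam gam (i , y) → InShape lam gam (i′ , y) → i < i′ → T i y < T i′ y
  colStrict = proj₂ (proj₂ SS) _ _ _

  lattice-at : ∀ {i x} b → InShape lam gam (i , x) →
    labelCount (suc (suc b)) (readingTo i x) ≤ labelCount (suc b) (readingTo i x)
  lattice-at {suc r} {x} b (_ , λ<x , x≤γ) =
    let Z , eq = readingTo-prefix sub (!-nonzero gam r (<-≤-trans (≤-<-trans z≤n λ<x) x≤γ))
                                      λ<x (m≤n⇒m≤1+n x≤γ)
    in LatticeWord-labelPrefix (readingTo (suc r) x) Z lat eq b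

  far-below-not-right : ∀ {b r j r′ j′} → InShape lam gam (r , j) → T r j ≡ suc b →
    InShape lam gam (r′ , j′) → T r′ j′ ≡ suc (suc b) → suc r < r′ → j < j′ → ⊥
  far-below-not-right {b} {r} {j} {r′} {j′} d∈ Td c∈ Tc r+1<r′ j<j′ = <-irrefl refl (begin-strict
    suc (suc b)         ≡⟨ cong suc Td ⟨
    suc (T r j)         ≤⟨ s≤s (rowWeak d∈ (inRect ≤-refl (n≤1+n r)) (<⇒≤ j<j′)) ⟩
    suc (T r j′)        ≤⟨ colStrict (inRect ≤-refl (n≤1+n r)) (inRect (n≤1+n r) ≤-refl) ≤-refl ⟩
    T (suc r) j′        <⟨ colStrict (inRect (n≤1+n r) ≤-refl) c∈ r+1<r′ ⟩
    T r′ j′             ≡⟨ Tc ⟩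
    suc (suc b)         ∎)
    where
    open ≤-Reasoning
    inRect : ∀ {i} → r ≤ i → i ≤ suc r → InShape lam gam (i , j′)
    inRect r≤i i≤r+1 =
      skewShape-convex Pl Pg d∈ c∈ r≤i (≤-trans i≤r+1 (<⇒≤ r+1<r′)) (<⇒≤ j<j′) ≤-refl

  -- x starts the run of β's of row i through column j. Row i is β and row i + 1 is β + 1 on
  -- columns x … j′, so the lattice condition just after reading cell (i + 1 , x) forces j′ ≤ j.
  module AdjacentRows {b r j j′ x} (d∈ : InShape lam gam (suc r , j)) (Td : T (suc r) j ≡ suc b)
    (c∈ : InShape lam gam (suc (suc r) , j′)) (Tc : T (suc (suc r)) j′ ≡ suc (suc b)) (j<j′ : j < j′)
    (λ<x : lam ! suc r < x) (x≤j : x ≤ j) (Tx : T (suc r) x ≡ suc b)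
    (left : ∀ {y} → suc (lam ! suc r) ≤ y → y < x → T (suc r) y ≢ suc b)
    where

    private
      i β β′ : ℕ
      i = suc r
      β = suc b
      β′ = suc (suc b)
      j≤γ : j ≤ gam ! i
      j≤γ = proj₂ (proj₂ d∈)
      j′≤γ′ : j′ ≤ gam ! suc i
      j′≤γ′ = proj₂ (proj₂ c∈)
      x≤j′ : x ≤ j′
      x≤j′ = ≤-trans x≤j (<⇒≤ j<j′)

    inRect : ∀ {i′ y} → i ≤ i′ → i′ ≤ suc i → x ≤ y → y ≤ j′ → InShape lam gam (i′ , y)
    inRect = skewShape-convex Pl Pg (s≤s z≤n , λ<x , ≤-trans x≤j j≤γ) c∈

    up : ∀ {y} → x ≤ y → y ≤ j′ → InShape lam gam (i , y)
    up = inRect ≤-refl (n≤1+n i)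

    down : ∀ {y} → x ≤ y → y ≤ j′ → InShape lam gam (suc i , y)
    down = inRect (n≤1+n i) ≤-refl

    upper-j′ : T i j′ ≡ β
    upper-j′ = ≤-antisym (≤-pred (subst (T i j′ <_) Tc (colStrict (up x≤j′ ≤-refl) c∈ ≤-refl)))
                         (subst (_≤ T i j′) Td (rowWeak d∈ (up x≤j′ ≤-refl) (<⇒≤ j<j′)))

    upper : ∀ {y} → x ≤ y → y ≤ j′ → T i y ≡ β
    upper x≤y y≤j′ = ≤-antisym
      (≤-trans (rowWeak (up x≤y y≤j′) (up x≤j′ ≤-refl) y≤j′) (≤-reflexive upper-j′))
      (subst (_≤ T i _) Tx (rowWeak (up ≤-refl x≤j′) (up x≤y y≤j′) x≤y))

    lower : ∀ {y} → x ≤ y → y ≤ j′ → T (suc i) y ≡ β′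
    lower x≤y y≤j′ = ≤-antisym
      (≤-trans (rowWeak (down x≤y y≤j′) c∈ y≤j′) (≤-reflexive Tc))
      (subst (_< T (suc i) _) (upper x≤y y≤j′)
        (colStrict (up x≤y y≤j′) (down x≤y y≤j′) ≤-refl))

    lower-no-β : ∀ {y} → x ≤ y → y ≤ gam ! suc i → T (suc i) y ≢ β
    lower-no-β x≤y y≤γ′ Ty = <-irrefl refl (subst₂ _≤_ (lower ≤-refl x≤j′) Ty (rowWeak x∈ y∈ x≤y))
      where
      x∈ : InShape lam gam (suc i , x)
      x∈ = down ≤-refl x≤j′
      y∈ : InShape lam gam (suc i , _)
      y∈ = s≤s z≤n , <-≤-trans (proj₁ (proj₂ x∈)) x≤y , y≤γ′

    count-β′ : labelCount β′ (readingTo (suc i) x) ≡ labelCount β′ (readingTo (suc i) j′) + (j′ ∸ x)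
    count-β′ =
      labelCount-readingTo-all i x≤j′ (m≤n⇒m≤1+n j′≤γ′) (λ x≤y y<j′ → lower x≤y (<⇒≤ y<j′))

    count-β : labelCount β (readingTo (suc i) x) ≡ labelCount β (readingTo i j) + (j ∸ x)
    count-β = begin
      labelCount β (readingTo (suc i) x)
        ≡⟨ labelCount-readingTo-none i (m≤n⇒m≤1+n (≤-trans x≤j′ j′≤γ′)) ≤-refl
             (λ x≤y y< → lower-no-β x≤y (≤-pred y<)) ⟩
      labelCount β (readingTo (suc i) (suc (gam ! suc i)))
        ≡⟨ cong (labelCount β) (readingTo-rowEnd i) ⟩
      labelCount β (readingTo i (suc (lam ! i)))
        ≡⟨ labelCount-readingTo-none r λ<x (m≤n⇒m≤1+n (≤-trans x≤j j≤γ)) left ⟩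
      labelCount β (readingTo i x)
        ≡⟨ labelCount-readingTo-all r x≤j (m≤n⇒m≤1+n j≤γ)
             (λ x≤y y<j → upper x≤y (≤-trans (<⇒≤ y<j) (<⇒≤ j<j′))) ⟩
      labelCount β (readingTo i j) + (j ∸ x)
        ∎
      where open ≡-Reasoning

    not-right : labelCount β (readingTo i j) ≡ labelCount β′ (readingTo (suc i) j′) → ⊥
    not-right same = <⇒≱ j<j′ (subst₂ _≤_ (m∸n+n≡m x≤j′) (m∸n+n≡m x≤j) (+-monoˡ-≤ x
      (+-cancelˡ-≤ (labelCount β (readingTo i j)) _ _
        (subst₂ _≤_ (trans count-β′ (cong (_+ (j′ ∸ x)) (sym same))) count-β
          (lattice-at b (down ≤-refl x≤j′))))))

  adjacent-below-not-right : ∀ {b r j j′} → InShape lam gam (suc r , j) → T (suc r) j ≡ suc b →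
    InShape lam gam (suc (suc r) , j′) → T (suc (suc r)) j′ ≡ suc (suc b) → j < j′ →
    labelCount (suc b) (readingTo (suc r) j) ≢ labelCount (suc (suc b)) (readingTo (suc (suc r)) j′)
  adjacent-below-not-right {b} {r} d∈@(_ , λ<j , _) Td c∈ Tc j<j′
    with x , λ<x , x≤j , Tx , left ← least-satisfying (λ y → T (suc r) y ≟ suc b) λ<j Td =
    AdjacentRows.not-right d∈ Td c∈ Tc j<j′ λ<x x≤j Tx left

  matched-below-left : ∀ {b r j r′ j′} → InShape lam gam (r , j) → T r j ≡ suc b →
    InShape lam gam (r′ , j′) → T r′ j′ ≡ suc (suc b) → cellAt r j ≺ cellAt r′ j′ →
    labelCount (suc b) (readingTo r j) ≡ labelCount (suc (suc b)) (readingTo r′ j′) →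
    r < r′ × j′ ≤ j
  matched-below-left d∈ Td c∈ Tc (inj₂ (refl , j′<j)) _ =
    ⊥-elim (<-irrefl refl (subst₂ _≤_ Tc Td (rowWeak c∈ d∈ (<⇒≤ j′<j))))
  matched-below-left {j = j} {j′ = j′} d∈@(s≤s z≤n , _) Td c∈ Tc (inj₁ r<r′) same with j′ ≤? j
  ... | yes j′≤j = r<r′ , j′≤j
  ... | no j′≰j with m≤n⇒m<n∨m≡n r<r′
  ...   | inj₁ r+1<r′ = ⊥-elim (far-below-not-right d∈ Td c∈ Tc r+1<r′ (≰⇒> j′≰j))
  ...   | inj₂ refl   = ⊥-elim (adjacent-below-not-right d∈ Td c∈ Tc (≰⇒> j′≰j) same)

module Forward {lam gam : List ℕ} {T : Tableau} (Pl : IsPartition lam) (Pg : IsPartition gam)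
  (sub : lam ⊆ₚ gam) (SS : SemiStandard lam gam T) (lat : LatticeWord (map proj₂ (Reading.readingList lam gam T)))
  where
  open Reading lam gam T
  open Matching Pl Pg sub SS lat

  -- the k-th β + 1 is matched with the k-th β, so the β-cell d is unmatched in P iff P has no more
  -- β + 1's than there are β's before d
  UnmatchedOnTop : List LCell → List (List LCell) → Set
  UnmatchedOnTop P ss = ∀ {b} A {d C} → P ≡ A ++ d ∷ C → proj₂ d ≡ suc b →
    labelCount (suc (suc b)) P ≤ labelCount (suc b) A → Any (TopIs d) ss

  record BallotCover (P : List LCell) : Set where
    constructor ballotCover
    field
      seqs   : List (List LCell)
      ballot : All BallotSequence seqs
      covers : concat seqs ↭ P
      onTop  : UnmatchedOnTop P seqs

  reading-split : ∀ {P c Z A d C} → readingList ≡ P ++ c ∷ Z → P ≡ A ++ d ∷ C →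
    readingList ≡ A ++ d ∷ (C ++ c ∷ Z)
  reading-split {c = c} {Z} {A} {d} {C} eqc refl = trans eqc (++-assoc A (d ∷ C) (c ∷ Z))

  unmatched-∷ʳ : ∀ {b P c A e C} → P ++ c ∷ [] ≡ A ++ e ∷ C →
    labelCount (suc (suc b)) (P ++ c ∷ []) ≤ labelCount (suc b) A →
    e ≡ c ⊎ ∃[ C′ ] (P ≡ A ++ e ∷ C′ × labelCount (suc (suc b)) P ≤ labelCount (suc b) A)
  unmatched-∷ʳ {P = P} {A = A} eq h with ∷ʳ-split P A eq
  ... | inj₁ (_ , e≡c) = inj₁ e≡c
  ... | inj₂ (C′ , P≡) = inj₂ (C′ , P≡ , ≤-trans (countWhere-≤-++ _ P _) h)

  lattice-before : ∀ {b P c Z} → readingList ≡ P ++ c ∷ Z → proj₂ c ≡ suc (suc b) →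
    labelCount (suc (suc b)) P < labelCount (suc b) P
  lattice-before {b} {P} {c} {Z} eqc lc =
    subst₂ _≤_ (countWhere-∷ʳ-accept _ P lc) (countWhere-∷ʳ-reject _ P (λ l → 1+n≢n (trans (sym lc) l)))
      (LatticeWord-labelPrefix (P ++ c ∷ []) Z lat (trans eqc (sym (++-assoc P _ Z))) b)

  matching-cell : ∀ {b P c Z} → readingList ≡ P ++ c ∷ Z → proj₂ c ≡ suc (suc b) →
    ∃[ P₁ ] ∃[ d ] ∃[ P₂ ] (P ≡ P₁ ++ d ∷ P₂ × proj₂ d ≡ suc b ×
      labelCount (suc b) P₁ ≡ labelCount (suc (suc b)) P × Next d (c ∷ []))
  matching-cell {b} {P} {c} {Z} eqc lc
    with P₁ , d , P₂ , P≡ , ld , rank ←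
           countWhere-occurrence _ (labelCount (suc (suc b)) P) P (lattice-before eqc lc)
    with position r j d∈ refl pd ← locate sub (length gam) P₁ (reading-split eqc P≡)
       | position r′ j′ c∈ refl pc ← locate sub (length gam) P eqc =
    P₁ , d , P₂ , P≡ , ld , rank , matched-below-left d∈ ld c∈ lc d≺c counts
    where
    d≺c : cellAt r j ≺ cellAt r′ j′
    d≺c = AllPairs-across (subst (AllPairs _≺_) eqc readingList-sorted)
                          (subst (_ ∈_) (sym P≡) (∈-++⁺ʳ P₁ (here refl))) (here refl)
    counts : labelCount (suc b) (readingTo r j) ≡ labelCount (suc (suc b)) (readingTo r′ j′)
    counts = begin
      labelCount (suc b) (readingTo r j)          ≡⟨ cong (labelCount (suc b)) pd ⟨
      labelCount (suc b) (P₁ ++ _ ∷ [])           ≡⟨ countWhere-∷ʳ-accept _ P₁ ld ⟩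
      suc (labelCount (suc b) P₁)                 ≡⟨ cong suc rank ⟩
      suc (labelCount (suc (suc b)) P)            ≡⟨ countWhere-∷ʳ-accept _ P lc ⟨
      labelCount (suc (suc b)) (P ++ _ ∷ [])      ≡⟨ cong (labelCount (suc (suc b))) pc ⟩
      labelCount (suc (suc b)) (readingTo r′ j′)  ∎
      where open ≡-Reasoning

  cover-∷ʳ-new : ∀ {P c} → proj₂ c ≡ 1 → BallotCover P → BallotCover (P ++ c ∷ [])
  cover-∷ʳ-new {P} {c} lc (ballotCover ss bs cov top) =
    ballotCover ((c ∷ []) ∷ ss) (((λ ()) , lc , _ , _) ∷ bs) (↭-trans (↭-prep c cov) (∷↭∷ʳ c P)) top′
    where
    top′ : UnmatchedOnTop (P ++ c ∷ []) ((c ∷ []) ∷ ss)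
    top′ A eq ld h with unmatched-∷ʳ eq h
    ... | inj₁ refl              = here ([] , refl)
    ... | inj₂ (_ , P≡ , h′)   = there (top A P≡ ld h′)

  cover-∷ʳ-push : ∀ {b P c Z} → readingList ≡ P ++ c ∷ Z → proj₂ c ≡ suc (suc b) →
    BallotCover P → BallotCover (P ++ c ∷ [])
  cover-∷ʳ-push {b} {P} {c} {Z} eqc lc (ballotCover ss bs cov top)
    with P₁ , d , P₂ , P≡ , ld , rank , next ← matching-cell eqc lc =
    ballotCover (pushOnto d-top c) (pushOnto-All d-top grow bs) covers top′
    where
    d-top : Any (TopIs d) ss
    d-top = top P₁ P≡ ld (≤-reflexive (sym rank))
    grow : ∀ {s} → TopIs d s → BallotSequence s → BallotSequence (c ∷ s)
    grow top-s ballot-s = BallotSequence-∷ ballot-s top-s next (trans lc (cong suc (sym ld)))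
    covers : concat (pushOnto d-top c) ↭ P ++ c ∷ []
    covers = ↭-trans (pushOnto-concat d-top) (↭-trans (↭-prep c cov) (∷↭∷ʳ c P))
    top′ : UnmatchedOnTop (P ++ c ∷ []) (pushOnto d-top c)
    top′ {b′} A {e} eq le h with unmatched-∷ʳ eq h
    ... | inj₁ refl            = pushOnto-top d-top
    ... | inj₂ (_ , P≡′ , h′) = pushOnto-keeps d-top e≢d (top A P≡′ le h′)
      where
      e≢d : e ≢ d
      e≢d refl
        with refl ← suc-injective (trans (sym le) ld)
           | refl ← AllPairs-split-unique (λ {e} → ≺-irrefl {e}) A P₁ readingList-sorted
                                          (reading-split eqc P≡′) (reading-split eqc P≡) =
        <-irrefl refl (subst₂ _≤_ (countWhere-∷ʳ-accept _ P lc) rank h)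

  label-positive : ∀ {P c Z} → readingList ≡ P ++ c ∷ Z → 1 ≤ proj₂ c
  label-positive eqc with position i j c∈ refl _ ← locate sub (length gam) _ eqc = proj₁ SS i j c∈

  cover-∷ʳ : ∀ {P c Z} → readingList ≡ P ++ c ∷ Z → BallotCover P → BallotCover (P ++ c ∷ [])
  cover-∷ʳ {c = c} eqc cover with proj₂ c in lc | label-positive eqc
  ... | suc zero    | _ = cover-∷ʳ-new lc cover
  ... | suc (suc b) | _ = cover-∷ʳ-push eqc lc cover

  readingList-cover : BallotCover readingList
  readingList-cover = go [] readingList refl (ballotCover [] [] ↭-refl no-cells)
    where
    no-cells : UnmatchedOnTop [] []
    no-cells A eq with () ← ++-conicalʳ A _ (sym eq)
    go : ∀ P Z → readingList ≡ P ++ Z → BallotCover P → BallotCover readingList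
    go P []      eq cover = subst BallotCover (sym (trans eq (++-identityʳ P))) cover
    go P (c ∷ Z) eq cover = go (P ++ c ∷ []) Z (trans eq (sym (++-assoc P _ Z))) (cover-∷ʳ eq cover)

  partitioned : PartitionedIntoBallot lam gam T
  partitioned = let ballotCover ss bs cov _ = readingList-cover
                in ss , bs , ↭-trans cov (↭-sym labeledCells↭readingList)

-- A partition into ballot sequences gives a lattice reverse row word

module Backward {lam gam : List ℕ} {T : Tableau} where
  open Reading lam gam T
  open import Data.List.Membership.DecPropositional (≡-dec (≡-dec _≟_ _≟_) _≟_) using (_∈?_)

  module Prefix (A Z : List LCell) (split : readingList ≡ A ++ Z) where

    sorted : AllPairs _≺_ (A ++ Z)
    sorted = subst (AllPairs _≺_) split readingList-sorted

    read-earlier : ∀ {x y} → x ∈ readingList → y ∈ A → row x < row y → x ∈ A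
    read-earlier x∈ y∈A rx<ry with ∈-++⁻ A (subst (_ ∈_) split x∈)
    ... | inj₁ x∈A = x∈A
    ... | inj₂ x∈Z with AllPairs-across sorted y∈A x∈Z
    ...   | inj₁ ry<rx       = contradiction rx<ry (<-asym ry<rx)
    ...   | inj₂ (ry≡rx , _) = contradiction rx<ry (<-irrefl (sym ry≡rx))

    labelled? : ∀ c → Decidable (λ e → proj₂ e ≡ c × e ∈ A)
    labelled? c e = (proj₂ e ≟ c) ×-dec (e ∈? A)

    labelIn : ℕ → List LCell → ℕ
    labelIn c = countWhere (labelled? c)

    labelIn-skip : ∀ {c x} t → proj₂ x ≢ c → labelIn c (x ∷ t) ≡ labelIn c t
    labelIn-skip t l≢c = countWhere-reject (labelled? _) t (l≢c ∘ proj₁)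

    labelIn-readingList : ∀ c → labelIn c readingList ≡ labelCount c A
    labelIn-readingList c = begin
      labelIn c readingList                    ≡⟨ cong (labelIn c) split ⟩
      labelIn c (A ++ Z)                       ≡⟨ countWhere-++ (labelled? c) A Z ⟩
      labelIn c A + labelIn c Z
        ≡⟨ cong₂ _+_ (countWhere-×-all label? (_∈? A) (All.tabulate (λ e∈A → e∈A)))
                     (countWhere-×-none label? (_∈? A) (All.tabulate not-in-A)) ⟩
      labelCount c A + 0                       ≡⟨ +-identityʳ _ ⟩
      labelCount c A                           ∎
      where
      open ≡-Reasoning
      label? : Decidable (λ (e : LCell) → proj₂ e ≡ c)
      label? e = proj₂ e ≟ c
      not-in-A : ∀ {z} → z ∈ Z → z ∉ A
      not-in-A {z} z∈Z z∈A = ≺-irrefl {z} (AllPairs-across sorted z∈A z∈Z)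

    ascending-absent : ∀ {c n t} → Ascending n t → c < n → labelIn c t ≡ 0
    ascending-absent {t = []}    _               _   = refl
    ascending-absent {t = _ ∷ t} (lx , _ , asc) c<n =
      trans (labelIn-skip t (λ l → <-irrefl (trans (sym l) lx) c<n)) (ascending-absent asc (m<n⇒m<1+n c<n))

    -- each ballot sequence has at most one cell of each label, and its c-cell lies above its (c+1)-cell
    ascending-count : ∀ {c n t} → Ascending n t → n ≤ c → All (_∈ readingList) t →
      labelIn (suc c) t ≤ labelIn c t
    ascending-count {t = []} _ _ _ = z≤n
    ascending-count {c} {n} {x ∷ t} (lx , nx , asc) n≤c (x∈ ∷ t∈) with m≤n⇒m<n∨m≡n n≤c
    ... | inj₁ n<c = subst₂ _≤_
      (sym (labelIn-skip t (λ l → <-irrefl (trans (sym lx) l) (m<n⇒m<1+n n<c))))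
      (sym (labelIn-skip t (λ l → <-irrefl (trans (sym lx) l) n<c)))
      (ascending-count asc n<c t∈)
    ... | inj₂ refl =
      subst (_≤ labelIn c (x ∷ t)) (sym (labelIn-skip t (λ l → 1+n≢n (trans (sym l) lx)))) (successor t nx asc)
      where
      successor : ∀ t → Next x t → Ascending (suc c) t → labelIn (suc c) t ≤ labelIn c (x ∷ t)
      successor []       _  _              = z≤n
      successor (y ∷ t′) nx (ly , _ , asc′) = by-membership (y ∈? A)
        where
        none-after : labelIn (suc c) t′ ≡ 0
        none-after = ascending-absent asc′ (n<1+n _)
        by-membership : Dec (y ∈ A) → labelIn (suc c) (y ∷ t′) ≤ labelIn c (x ∷ y ∷ t′)
        by-membership (yes y∈A) = subst₂ _≤_
          (sym (trans (countWhere-accept (labelled? _) t′ (ly , y∈A)) (cong suc none-after)))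
          (sym (countWhere-accept (labelled? _) (y ∷ t′) (lx , read-earlier x∈ y∈A (proj₁ nx))))
          (s≤s z≤n)
        by-membership (no y∉A) = subst (_≤ labelIn c (x ∷ y ∷ t′))
          (sym (trans (countWhere-reject (labelled? _) t′ (y∉A ∘ proj₂)) none-after)) z≤n

    ballots-count : ∀ {b} ss → All BallotSequence ss → All (_∈ readingList) (concat ss) →
      labelIn (suc (suc b)) (concat ss) ≤ labelIn (suc b) (concat ss)
    ballots-count []       _               _  = z≤n
    ballots-count {b} (s ∷ ss) ((_ , asc) ∷ bs) ∈s =
      subst₂ _≤_ (sym (countWhere-++ (labelled? _) s _)) (sym (countWhere-++ (labelled? _) s _))
        (+-mono-≤ in-s (ballots-count ss bs (Allₚ.++⁻ʳ s ∈s)))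
      where
      in-s : labelIn (suc (suc b)) s ≤ labelIn (suc b) s
      in-s = subst₂ _≤_ (countWhere-↭ (labelled? _) (↭-reverse s)) (countWhere-↭ (labelled? _) (↭-reverse s))
               (ascending-count asc (s≤s z≤n) (All-resp-↭ (↭-sym (↭-reverse s)) (Allₚ.++⁻ˡ s ∈s)))

  lattice : PartitionedIntoBallot lam gam T → LatticeWord (map proj₂ readingList)
  lattice (ss , bs , cov) n b =
    subst₂ _≤_ (counts (suc (suc b))) (counts (suc b)) (ballots-count ss bs (All.tabulate (∈-resp-↭ cov′)))
    where
    open Prefix (take n readingList) (drop n readingList) (sym (take++drop≡id n readingList))
    cov′ : concat ss ↭ readingList
    cov′ = ↭-trans cov labeledCells↭readingList
    counts : ∀ c → labelIn c (concat ss) ≡ count c (take n (map proj₂ readingList))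
    counts c = begin
      labelIn c (concat ss)                          ≡⟨ countWhere-↭ (labelled? c) cov′ ⟩
      labelIn c readingList                          ≡⟨ labelIn-readingList c ⟩
      labelCount c (take n readingList)              ≡⟨ countWhere-map (_≟ c) proj₂ (take n readingList) ⟨
      count c (map proj₂ (take n readingList))       ≡⟨ cong (count c) (take-map n readingList) ⟨
      count c (take n (map proj₂ readingList))       ∎
      where open ≡-Reasoning

lemma2p1 : (lam gam : List ℕ) → IsPartition lam → IsPartition gam → lam ⊆ₚ gam →
    (T : Tableau) → SemiStandard lam gam T →
    (LRTableau lam gam T ⇔ PartitionedIntoBallot lam gam T)
lemma2p1 lam gam Pl Pg sub T SS = mk⇔
  (λ (_ , lat) → Forward.partitioned Pl Pg sub SS (subst LatticeWord reverseRowWord≡ lat))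
  (λ cover → SS , subst LatticeWord (sym reverseRowWord≡) (Backward.lattice {lam} {gam} {T} cover))
  where open Reading lam gam T
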